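{- Let $b, c \geq 0$ be integers, not both $0$, and let \[ P = \{ x \in \mathbf{R}^{n-1} \mid c \cdot (\lvert x_1 \rvert + \cdots + \lvert x_{n-1} \rvert) + b \cdot \max\{ \lvert x_1 \rvert, \ldots, \lvert x_{n-1} \rvert \} \leq 1 \} . \] Then the Ehrhart series $\operatorname{Ehr}_P(t) := \sum_{k \geq 0} \lvert kP \cap \mathbf{Z}^{n-1} \rvert \, t^k$ of $P$ is \[ \operatorname{Ehr}_P(t) = \begin{cases} [c]_t (1+t^c)^{n-1}/(1-t^c)^n & \text{if } b = 0, \\ [b]_t \sum_{k \geq 0} \left( [k+1]_{t^c} + t^c [k]_{t^c} \right)^{n-1} t^{bk} & \text{if } b \geq 1. \end{cases} \]
   Context: For $k \in \mathbf{N}$ and a variable $q$, $[k]_q := 1 + q + q^2 + \cdots + q^{k-1}$ (so $[0]_q = 0$). -}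

module Defs where

open import Data.Nat using (ℕ; zero; suc; _+_; _*_; _∸_; _≤_; _⊔_; _≡ᵇ_)
open import Data.Bool using (if_then_else_)
open import Data.Integer using (ℤ; ∣_∣)
open import Data.Vec using (Vec; map; foldr; sum)
open import Data.List using (List; length)
open import Data.List.Membership.Propositional using (_∈_)
open import Data.List.Relation.Unary.Unique.Propositional using (Unique)
open import Data.Product using (Σ; _×_)
open import Relation.Binary.PropositionalEquality using (_≡_)

InKP : (d b c k : ℕ) → Vec ℤ d → Set
InKP d b c k x =
  c * sum (map ∣_∣ x) + b * foldr (λ _ → ℕ) _⊔_ 0 (map ∣_∣ x) ≤ k

HasCard : {A : Set} → (A → Set) → ℕ → Set
HasCard {A} P N =
  Σ (List A) λ L → Unique L × ((x : A) → (x ∈ L → P x) × (P x → x ∈ L))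
                   × length L ≡ N

-- Formal power series in t with ℕ coefficients, as coefficient functions

FPS : Set
FPS = ℕ → ℕ

sumTo : ℕ → (ℕ → ℕ) → ℕ
sumTo zero f = 0
sumTo (suc n) f = sumTo n f + f n

_⊕_ : FPS → FPS → FPS
(f ⊕ g) k = f k + g k

_⊛_ : FPS → FPS → FPS
(f ⊛ g) k = sumTo (suc k) (λ i → f i * g (k ∸ i))

one : FPS
one k = if k ≡ᵇ 0 then 1 else 0

mono : ℕ → FPS
mono a k = if a ≡ᵇ k then 1 else 0

pow : FPS → ℕ → FPS
pow f zero = one
pow f (suc m) = f ⊛ pow f m

fsum : ℕ → (ℕ → FPS) → FPS
fsum n F k = sumTo n (λ j → F j k)

bracket : ℕ → FPS → FPS
bracket k q = fsum k (λ j → pow q j)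

-- Σ_{k≥0} F k, for a family with F k of order ≥ k (so the sum converges
-- t-adically and the coefficient of t^m only involves k ≤ m)
infSum : (ℕ → FPS) → FPS
infSum F m = sumTo (suc m) (λ k → F k m)

-- 1/(1 - t^c) = Σ_{m≥0} t^{cm}   (c ≥ 1)
geom : ℕ → FPS
geom c = infSum (λ m → pow (mono c) m)

-- right-hand side of Corollary 4.5, with n = d + 1
ehrRHS : (b c d : ℕ) → FPS
ehrRHS zero c d =
  bracket c (mono 1) ⊛ (pow (one ⊕ mono c) d ⊛ pow (geom c) (suc d))
ehrRHS (suc b') c d =
  bracket (suc b') (mono 1) ⊛
    infSum (λ k → pow (bracket (suc k) (mono c) ⊕ (mono c ⊛ bracket k (mono c))) d
                   ⊛ pow (mono (suc b')) k)

-- For b ≥ 1 write A_k = [k+1]_{t^c} + t^c [k]_{t^c} = Σ_{|z| ≤ k} t^{c|z|}, so that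
-- A_k^{n-1} t^{bk} = Σ_{max|xᵢ| ≤ k} t^{c Σ|xᵢ| + bk}.  Summing over k, a point x contributes
-- Σ_{k ≥ max|xᵢ|} t^{c Σ|xᵢ| + bk}; multiplying by [b]_t fills the gaps of length b between
-- consecutive exponents, so x contributes t^{c Σ|xᵢ| + b max|xᵢ|}/(1 - t), whose coefficient of t^k
-- is 1 exactly when x ∈ kP.  For b = 0 the same happens with (1 + t^c)/(1 - t^c) = Σ_{z ∈ ℤ} t^{c|z|}
-- and [c]_t/(1 - t^c) = 1/(1 - t).  Coefficients are compared by writing both sides as sums over a
-- finite box of lattice points, which also enumerates kP.
module Submission where

open import Defs
open import Algebra.Bundles using (CommutativeSemigroup)
open import Data.Bool using (if_then_else_)
open import Data.Empty using (⊥-elim)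
open import Data.Integer using (ℤ; -[1+_]; ∣_∣) renaming (+_ to pos)
open import Data.Integer.Properties using (+-injective; -[1+-injective)
open import Data.List using (List; []; _∷_; _++_; map; applyUpTo; upTo; cartesianProductWith; filter; length)
open import Data.List.Membership.Propositional using (_∈_)
open import Data.List.Membership.Propositional.Properties
  using (∈-map⁺; ∈-map⁻; ∈-++⁺ˡ; ∈-++⁺ʳ; ∈-upTo⁺; ∈-filter⁺; ∈-filter⁻; ∈-cartesianProductWith⁺)
import Data.List.Relation.Unary.All as ListAll
import Data.List.Relation.Unary.AllPairs as AllPairs
open import Data.List.Relation.Unary.Any using (here)
open import Data.List.Relation.Unary.Unique.Propositional using (Unique)
import Data.List.Relation.Unary.Unique.Propositional.Properties as Unique
open import Data.Nat using (ℕ; zero; suc; _+_; _*_; _∸_; _≤_; _<_; _⊔_; _≟_; _≤?_; _<?_; z≤n; s≤s; s≤s⁻¹)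
open import Data.Nat.Properties
open import Data.Nat.Solver using (module +-*-Solver)
open import Data.Product using (_×_; _,_; proj₂; uncurry)
open import Data.Vec using (Vec; foldr; sum) renaming ([] to []ᵥ; _∷_ to _∷ᵥ_; map to mapᵥ)
open import Data.Vec.Properties using (∷-injective)
open import Data.Vec.Relation.Unary.All using (All) renaming ([] to []ᵃ; _∷_ to _∷ᵃ_; map to mapᵃ)
open import Function using (_∘_)
open import Relation.Nullary using (¬_; Dec; yes; no; does)
open import Relation.Nullary.Decidable using (_×-dec_)
open import Relation.Binary.PropositionalEquality
open +-*-Solver using (solve; _:=_; _:+_; _:*_)

-- Indicators and finite sums

-- Defined through `does` so that `χ (a ≟ n)` is definitionally `mono a n`.
χ : {P : Set} → Dec P → ℕ
χ p? = if does p? then 1 else 0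

χ-yes : {P : Set} (p? : Dec P) → P → χ p? ≡ 1
χ-yes (yes _) _ = refl
χ-yes (no ¬p) p = ⊥-elim (¬p p)

χ-no : {P : Set} (p? : Dec P) → ¬ P → χ p? ≡ 0
χ-no (yes p) ¬p = ⊥-elim (¬p p)
χ-no (no _)  _  = refl

χ-⇔ : {P Q : Set} (p? : Dec P) (q? : Dec Q) → (P → Q) → (Q → P) → χ p? ≡ χ q?
χ-⇔ (yes p) (yes q) _ _ = refl
χ-⇔ (yes p) (no ¬q) f _ = ⊥-elim (¬q (f p))
χ-⇔ (no ¬p) (yes q) _ g = ⊥-elim (¬p (g q))
χ-⇔ (no _)  (no _)  _ _ = refl

χ-× : {P Q : Set} (p? : Dec P) (q? : Dec Q) → χ p? * χ q? ≡ χ (p? ×-dec q?)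
χ-× (yes _) (yes _) = refl
χ-× (yes _) (no _)  = refl
χ-× (no _)  _       = refl

χ*χ-exclusive : {P Q : Set} (p? : Dec P) (q? : Dec Q) → (P → ¬ Q) → χ p? * χ q? ≡ 0
χ*χ-exclusive p? q? P⇒¬Q = trans (χ-× p? q?) (χ-no (p? ×-dec q?) (uncurry P⇒¬Q))

χ-⊔ : ∀ a b k → χ (a ≤? k) * χ (b ≤? k) ≡ χ (a ⊔ b ≤? k)
χ-⊔ a b k = trans (χ-× (a ≤? k) (b ≤? k))
  (χ-⇔ ((a ≤? k) ×-dec (b ≤? k)) (a ⊔ b ≤? k) (uncurry ⊔-lub)
       (λ a⊔b≤k → ≤-trans (m≤m⊔n a b) a⊔b≤k , ≤-trans (m≤n⊔m a b) a⊔b≤k))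

mono-sym : ∀ a n → mono a n ≡ mono n a
mono-sym a n = χ-⇔ (a ≟ n) (n ≟ a) sym sym

mono-∸ : ∀ t {m i} → i ≤ m → mono t (m ∸ i) ≡ χ (t ≤? m) * mono (m ∸ t) i
mono-∸ t {m} {i} i≤m = byCase (t ≤? m)
  where
  byCase : (t≤?m : Dec (t ≤ m)) → mono t (m ∸ i) ≡ χ t≤?m * mono (m ∸ t) i
  byCase (yes t≤m) = trans (χ-⇔ (t ≟ m ∸ i) (m ∸ t ≟ i)
                             (λ t≡m∸i → trans (cong (m ∸_) t≡m∸i) (m∸[m∸n]≡n i≤m))
                             (λ m∸t≡i → trans (sym (m∸[m∸n]≡n t≤m)) (cong (m ∸_) m∸t≡i)))
                           (sym (+-identityʳ _))
  byCase (no t≰m)  = χ-no (t ≟ m ∸ i) (λ t≡m∸i → t≰m (subst (_≤ m) (sym t≡m∸i) (m∸n≤m m i)))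

+-+-swap : ∀ a b c d → (a + b) + (c + d) ≡ (a + c) + (b + d)
+-+-swap = solve 4 (λ a b c d → (a :+ b) :+ (c :+ d) := (a :+ c) :+ (b :+ d)) refl

sumTo-cong : ∀ n {f g : ℕ → ℕ} → (∀ i → i < n → f i ≡ g i) → sumTo n f ≡ sumTo n g
sumTo-cong zero    eq = refl
sumTo-cong (suc n) eq = cong₂ _+_ (sumTo-cong n (λ i i<n → eq i (m<n⇒m<1+n i<n))) (eq n ≤-refl)

sumTo-zero : ∀ n {f : ℕ → ℕ} → (∀ i → i < n → f i ≡ 0) → sumTo n f ≡ 0
sumTo-zero zero    eq = refl
sumTo-zero (suc n) eq = cong₂ _+_ (sumTo-zero n (λ i i<n → eq i (m<n⇒m<1+n i<n))) (eq n ≤-refl)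

sumTo-+ : ∀ n (f g : ℕ → ℕ) → sumTo n (λ i → f i + g i) ≡ sumTo n f + sumTo n g
sumTo-+ zero    f g = refl
sumTo-+ (suc n) f g =
  trans (cong (_+ (f n + g n)) (sumTo-+ n f g)) (+-+-swap (sumTo n f) (sumTo n g) (f n) (g n))

sumTo-*ˡ : ∀ n a (f : ℕ → ℕ) → a * sumTo n f ≡ sumTo n (λ i → a * f i)
sumTo-*ˡ zero    a f = *-zeroʳ a
sumTo-*ˡ (suc n) a f = trans (*-distribˡ-+ a (sumTo n f) (f n)) (cong (_+ a * f n) (sumTo-*ˡ n a f))

sumTo-*ʳ : ∀ n a (f : ℕ → ℕ) → sumTo n f * a ≡ sumTo n (λ i → f i * a)
sumTo-*ʳ n a f =
  trans (*-comm (sumTo n f) a) (trans (sumTo-*ˡ n a f) (sumTo-cong n (λ i _ → *-comm a (f i))))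

sumTo-swap : ∀ n p (f : ℕ → ℕ → ℕ) →
  sumTo n (λ i → sumTo p (f i)) ≡ sumTo p (λ j → sumTo n (λ i → f i j))
sumTo-swap zero    p f = sym (sumTo-zero p (λ _ _ → refl))
sumTo-swap (suc n) p f = trans (cong (_+ sumTo p (f n)) (sumTo-swap n p f))
  (sym (sumTo-+ p (λ j → sumTo n (λ i → f i j)) (f n)))

sumTo-shiftˡ : ∀ n (f : ℕ → ℕ) → sumTo (suc n) f ≡ f 0 + sumTo n (λ i → f (suc i))
sumTo-shiftˡ zero    f = +-comm 0 (f 0)
sumTo-shiftˡ (suc n) f = trans (cong (_+ f (suc n)) (sumTo-shiftˡ n f)) (+-assoc (f 0) _ _)

sumTo-vanishing-tail : ∀ {p} n {f : ℕ → ℕ} → p ≤ n → (∀ i → p ≤ i → i < n → f i ≡ 0) →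
  sumTo n f ≡ sumTo p f
sumTo-vanishing-tail zero    z≤n _ = refl
sumTo-vanishing-tail {p} (suc n) p≤1+n eq with p ≤? n
... | yes p≤n = trans
  (cong₂ _+_ (sumTo-vanishing-tail n p≤n (λ i p≤i i<n → eq i p≤i (m<n⇒m<1+n i<n))) (eq n p≤n ≤-refl))
  (+-identityʳ _)
... | no p≰n with refl ← ≤-antisym p≤1+n (≰⇒> p≰n) = refl

sumTo-mono : ∀ N a (f : ℕ → ℕ) → sumTo N (λ i → mono a i * f i) ≡ χ (a <? N) * f a
sumTo-mono zero    a f = refl
sumTo-mono (suc N) a f = trans (cong (_+ mono a N * f N) (sumTo-mono N a f)) (addLast (a ≟ N))
  where
  addLast : (a≟N : Dec (a ≡ N)) → χ (a <? N) * f a + χ a≟N * f N ≡ χ (a <? suc N) * f a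
  addLast (yes refl) = cong₂ (λ x y → x * f a + y * f a)
    (χ-no (a <? a) (<-irrefl refl)) (sym (χ-yes (a <? suc a) ≤-refl))
  addLast (no a≢N)   = trans (+-identityʳ _) (cong (_* f a)
    (χ-⇔ (a <? N) (a <? suc N) m<n⇒m<1+n (λ a<1+N → ≤∧≢⇒< (s≤s⁻¹ a<1+N) a≢N)))

sumTo-χ< : ∀ {p} N (f : ℕ → ℕ) → p ≤ N → sumTo N (λ i → χ (i <? p) * f i) ≡ sumTo p f
sumTo-χ< {p} N f p≤N = trans
  (sumTo-vanishing-tail N p≤N (λ i p≤i _ → cong (_* f i) (χ-no (i <? p) (≤⇒≯ p≤i))))
  (sumTo-cong p (λ i i<p → trans (cong (_* f i) (χ-yes (i <? p) i<p)) (+-identityʳ (f i))))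

-- The Cauchy product

mono⊛mono : ∀ a b → (mono a ⊛ mono b) ≗ mono (a + b)
mono⊛mono a b j = trans (sumTo-mono (suc j) a (λ i → mono b (j ∸ i))) (onSupport (a <? suc j))
  where
  onSupport : (a<1+j : Dec (a < suc j)) → χ a<1+j * mono b (j ∸ a) ≡ mono (a + b) j
  onSupport (yes a<1+j) = trans (+-identityʳ _) (χ-⇔ (b ≟ j ∸ a) (a + b ≟ j)
    (λ b≡j∸a → trans (cong (a +_) b≡j∸a) (m+[n∸m]≡n (s≤s⁻¹ a<1+j)))
    (λ a+b≡j → trans (sym (m+n∸m≡n a b)) (cong (_∸ a) a+b≡j)))
  onSupport (no a≮1+j)  = sym (χ-no (a + b ≟ j)
    (λ a+b≡j → a≮1+j (s≤s (subst (a ≤_) a+b≡j (m≤m+n a b)))))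

sumTo-mono-shift : ∀ N n i (g : FPS) → n < N →
  sumTo N (λ j → g j * mono (i + j) n) ≡ χ (i <? suc n) * g (n ∸ i)
sumTo-mono-shift N n i g n<N with i ≤? n
... | yes i≤n = begin
  sumTo N (λ j → g j * mono (i + j) n)
    ≡⟨ sumTo-cong N (λ j _ → trans (*-comm (g j) _) (cong (_* g j) i+j≡n⇔n∸i≡j)) ⟩
  sumTo N (λ j → mono (n ∸ i) j * g j)
    ≡⟨ sumTo-mono N (n ∸ i) g ⟩
  χ (n ∸ i <? N) * g (n ∸ i)
    ≡⟨ cong (_* g (n ∸ i)) (trans (χ-yes (n ∸ i <? N) (≤-<-trans (m∸n≤m n i) n<N))
                                  (sym (χ-yes (i <? suc n) (s≤s i≤n)))) ⟩
  χ (i <? suc n) * g (n ∸ i)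
    ∎
  where
  open ≡-Reasoning
  i+j≡n⇔n∸i≡j : ∀ {j} → mono (i + j) n ≡ mono (n ∸ i) j
  i+j≡n⇔n∸i≡j {j} = χ-⇔ (i + j ≟ n) (n ∸ i ≟ j)
    (λ i+j≡n → trans (cong (_∸ i) (sym i+j≡n)) (m+n∸m≡n i j))
    (λ n∸i≡j → trans (cong (i +_) (sym n∸i≡j)) (m+[n∸m]≡n i≤n))
... | no i≰n = trans
  (sumTo-zero N (λ j _ → trans
    (cong (g j *_) (χ-no (i + j ≟ n) (λ i+j≡n → i≰n (subst (i ≤_) i+j≡n (m≤m+n i j)))))
    (*-zeroʳ (g j))))
  (sym (cong (_* g (n ∸ i)) (χ-no (i <? suc n) (λ i<1+n → i≰n (s≤s⁻¹ i<1+n)))))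

-- Spreading a convolution over the fixed square [0, N)² makes Fubini available.
⊛-square : ∀ N n (f g : FPS) → n < N →
  (f ⊛ g) n ≡ sumTo N (λ i → f i * sumTo N (λ j → g j * mono (i + j) n))
⊛-square N n f g n<N = sym (trans
  (sumTo-cong N (λ i _ → trans (cong (f i *_) (sumTo-mono-shift N n i g n<N))
                               (x∙yz≈y∙xz (f i) (χ (i <? suc n)) (g (n ∸ i)))))
  (sumTo-χ< N (λ i → f i * g (n ∸ i)) n<N))
  where open import Algebra.Properties.CommutativeSemigroup *-commutativeSemigroup using (x∙yz≈y∙xz)

⊛-square² : ∀ N n (f g : FPS) → n < N →
  (f ⊛ g) n ≡ sumTo N (λ i → sumTo N (λ j → f i * g j * mono (i + j) n))
⊛-square² N n f g n<N = trans (⊛-square N n f g n<N) (sumTo-cong N (λ i _ →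
  trans (sumTo-*ˡ N (f i) _) (sumTo-cong N (λ j _ → sym (*-assoc (f i) (g j) _)))))

sumTo-mono-eval² : ∀ N (F s : ℕ → ℕ → ℕ) (K : ℕ → ℕ) → (∀ t → N ≤ t → K t ≡ 0) →
  sumTo N (λ p → sumTo N (λ x → sumTo N (λ y → F x y * mono (s x y) p)) * K p)
  ≡ sumTo N (λ x → sumTo N (λ y → F x y * K (s x y)))
sumTo-mono-eval² N F s K K≥N≡0 = begin
  sumTo N (λ p → sumTo N (λ x → sumTo N (λ y → F x y * mono (s x y) p)) * K p)
    ≡⟨ sumTo-cong N (λ p _ → trans (sumTo-*ʳ N (K p) _) (sumTo-cong N (λ x _ →
         trans (sumTo-*ʳ N (K p) _) (sumTo-cong N (λ y _ → *-assoc (F x y) _ _))))) ⟩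
  sumTo N (λ p → sumTo N (λ x → sumTo N (λ y → F x y * (mono (s x y) p * K p))))
    ≡⟨ sumTo-swap N N _ ⟩
  sumTo N (λ x → sumTo N (λ p → sumTo N (λ y → F x y * (mono (s x y) p * K p))))
    ≡⟨ sumTo-cong N (λ x _ → sumTo-swap N N _) ⟩
  sumTo N (λ x → sumTo N (λ y → sumTo N (λ p → F x y * (mono (s x y) p * K p))))
    ≡⟨ sumTo-cong N (λ x _ → sumTo-cong N (λ y _ → trans (sym (sumTo-*ˡ N (F x y) _))
         (cong (F x y *_) (trans (sumTo-mono N (s x y) K) (evaluate (s x y <? N)))))) ⟩
  sumTo N (λ x → sumTo N (λ y → F x y * K (s x y)))
    ∎
  where
  open ≡-Reasoning
  evaluate : ∀ {t} (t<N : Dec (t < N)) → χ t<N * K t ≡ K t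
  evaluate (yes _)      = +-identityʳ _
  evaluate {t} (no t≮N) = sym (K≥N≡0 t (≮⇒≥ t≮N))

⊛-cong : ∀ {f f′ g g′} → f ≗ f′ → g ≗ g′ → (f ⊛ g) ≗ (f′ ⊛ g′)
⊛-cong f≗f′ g≗g′ n = sumTo-cong (suc n) (λ i _ → cong₂ _*_ (f≗f′ i) (g≗g′ (n ∸ i)))

⊛-comm : ∀ f g → (f ⊛ g) ≗ (g ⊛ f)
⊛-comm f g n = begin
  (f ⊛ g) n
    ≡⟨ ⊛-square² (suc n) n f g ≤-refl ⟩
  sumTo (suc n) (λ i → sumTo (suc n) (λ j → f i * g j * mono (i + j) n))
    ≡⟨ sumTo-swap (suc n) (suc n) _ ⟩
  sumTo (suc n) (λ j → sumTo (suc n) (λ i → f i * g j * mono (i + j) n))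
    ≡⟨ sumTo-cong (suc n) (λ j _ → sumTo-cong (suc n) (λ i _ →
         cong₂ _*_ (*-comm (f i) (g j)) (cong (λ t → mono t n) (+-comm i j)))) ⟩
  sumTo (suc n) (λ j → sumTo (suc n) (λ i → g j * f i * mono (j + i) n))
    ≡⟨ ⊛-square² (suc n) n g f ≤-refl ⟨
  (g ⊛ f) n
    ∎
  where open ≡-Reasoning

⊛-assoc : ∀ f g h → ((f ⊛ g) ⊛ h) ≗ (f ⊛ (g ⊛ h))
⊛-assoc f g h n = trans left (sym right)
  where
  open ≡-Reasoning
  N = suc n
  H : ℕ → ℕ
  H p = sumTo N (λ l → h l * mono (p + l) n)
  H≥N≡0 : ∀ t → N ≤ t → H t ≡ 0
  H≥N≡0 t N≤t = sumTo-zero N (λ l _ → trans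
    (cong (h l *_) (χ-no (t + l ≟ n) (λ t+l≡n → <⇒≱ N≤t (subst (t ≤_) t+l≡n (m≤m+n t l)))))
    (*-zeroʳ (h l)))
  left : ((f ⊛ g) ⊛ h) n ≡ sumTo N (λ a → sumTo N (λ b → f a * g b * H (a + b)))
  left = begin
    ((f ⊛ g) ⊛ h) n
      ≡⟨ ⊛-square N n (f ⊛ g) h ≤-refl ⟩
    sumTo N (λ p → (f ⊛ g) p * H p)
      ≡⟨ sumTo-cong N (λ p p<N → cong (_* H p) (⊛-square² N p f g p<N)) ⟩
    sumTo N (λ p → sumTo N (λ a → sumTo N (λ b → f a * g b * mono (a + b) p)) * H p)
      ≡⟨ sumTo-mono-eval² N (λ a b → f a * g b) _+_ H H≥N≡0 ⟩
    sumTo N (λ a → sumTo N (λ b → f a * g b * H (a + b)))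
      ∎
  inner : ∀ a → sumTo N (λ q → (g ⊛ h) q * mono (a + q) n)
              ≡ sumTo N (λ b → sumTo N (λ l → g b * h l * mono (a + (b + l)) n))
  inner a = begin
    sumTo N (λ q → (g ⊛ h) q * mono (a + q) n)
      ≡⟨ sumTo-cong N (λ q q<N → cong (_* mono (a + q) n) (⊛-square² N q g h q<N)) ⟩
    sumTo N (λ q → sumTo N (λ b → sumTo N (λ l → g b * h l * mono (b + l) q)) * mono (a + q) n)
      ≡⟨ sumTo-mono-eval² N (λ b l → g b * h l) _+_ (λ q → mono (a + q) n)
           (λ t N≤t → χ-no (a + t ≟ n) (λ a+t≡n → <⇒≱ N≤t (subst (t ≤_) a+t≡n (m≤n+m t a)))) ⟩
    sumTo N (λ b → sumTo N (λ l → g b * h l * mono (a + (b + l)) n))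
      ∎
  regroup : ∀ a b → f a * sumTo N (λ l → g b * h l * mono (a + (b + l)) n) ≡ f a * g b * H (a + b)
  regroup a b = begin
    f a * sumTo N (λ l → g b * h l * mono (a + (b + l)) n)
      ≡⟨ sumTo-*ˡ N (f a) _ ⟩
    sumTo N (λ l → f a * (g b * h l * mono (a + (b + l)) n))
      ≡⟨ sumTo-cong N (λ l _ → trans (cong (λ t → f a * (g b * h l * mono t n)) (sym (+-assoc a b l)))
                                     (reassoc (f a) (g b) (h l) _)) ⟩
    sumTo N (λ l → f a * g b * (h l * mono (a + b + l) n))
      ≡⟨ sumTo-*ˡ N (f a * g b) _ ⟨
    f a * g b * H (a + b)
      ∎
    where
    reassoc : ∀ x y z w → x * (y * z * w) ≡ x * y * (z * w)
    reassoc = solve 4 (λ x y z w → x :* ((y :* z) :* w) := (x :* y) :* (z :* w)) refl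
  right : (f ⊛ (g ⊛ h)) n ≡ sumTo N (λ a → sumTo N (λ b → f a * g b * H (a + b)))
  right = begin
    (f ⊛ (g ⊛ h)) n
      ≡⟨ ⊛-square N n f (g ⊛ h) ≤-refl ⟩
    sumTo N (λ a → f a * sumTo N (λ q → (g ⊛ h) q * mono (a + q) n))
      ≡⟨ sumTo-cong N (λ a _ → cong (f a *_) (inner a)) ⟩
    sumTo N (λ a → f a * sumTo N (λ b → sumTo N (λ l → g b * h l * mono (a + (b + l)) n)))
      ≡⟨ sumTo-cong N (λ a _ → trans (sumTo-*ˡ N (f a) _) (sumTo-cong N (λ b _ → regroup a b))) ⟩
    sumTo N (λ a → sumTo N (λ b → f a * g b * H (a + b)))
      ∎

⊛-commutativeSemigroup : CommutativeSemigroup _ _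
⊛-commutativeSemigroup = record
  { Carrier = FPS
  ; _≈_     = _≗_
  ; _∙_     = _⊛_
  ; isCommutativeSemigroup = record
    { isSemigroup = record
      { isMagma = record
        { isEquivalence = record
          { refl  = λ _ → refl
          ; sym   = λ f≗g n → sym (f≗g n)
          ; trans = λ f≗g g≗h n → trans (f≗g n) (g≗h n)
          }
        ; ∙-cong = ⊛-cong
        }
      ; assoc = ⊛-assoc
      }
    ; comm = ⊛-comm
    }
  }

open CommutativeSemigroup ⊛-commutativeSemigroup using () renaming (setoid to FPS-setoid; ∙-congˡ to ⊛-congˡ)
open import Algebra.Properties.CommutativeSemigroup ⊛-commutativeSemigroup using (interchange; x∙yz≈y∙xz)

one≗mono0 : one ≗ mono 0
one≗mono0 zero    = refl
one≗mono0 (suc i) = refl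

⊛-identityˡ : ∀ f → (one ⊛ f) ≗ f
⊛-identityˡ f n = trans (sumTo-cong (suc n) (λ i _ → cong (_* f (n ∸ i)) (one≗mono0 i)))
  (trans (sumTo-mono (suc n) 0 (λ i → f (n ∸ i))) (+-identityʳ (f n)))

⊛-distribʳ-⊕ : ∀ f g h → ((f ⊕ g) ⊛ h) ≗ ((f ⊛ h) ⊕ (g ⊛ h))
⊛-distribʳ-⊕ f g h n =
  trans (sumTo-cong (suc n) (λ i _ → *-distribʳ-+ (h (n ∸ i)) (f i) (g i))) (sumTo-+ (suc n) _ _)

pow⊛pow-suc : ∀ (P G : FPS) d → (pow P d ⊛ pow G (suc d)) ≗ (G ⊛ pow (P ⊛ G) d)
pow⊛pow-suc P G zero    = ⊛-identityˡ (G ⊛ one)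
pow⊛pow-suc P G (suc d) = begin
  (P ⊛ pow P d) ⊛ (G ⊛ pow G (suc d))   ≈⟨ interchange P (pow P d) G (pow G (suc d)) ⟩
  (P ⊛ G) ⊛ (pow P d ⊛ pow G (suc d))   ≈⟨ ⊛-congˡ {P ⊛ G} (pow⊛pow-suc P G d) ⟩
  (P ⊛ G) ⊛ (G ⊛ pow (P ⊛ G) d)         ≈⟨ x∙yz≈y∙xz (P ⊛ G) G (pow (P ⊛ G) d) ⟩
  G ⊛ pow (P ⊛ G) (suc d)               ∎
  where open import Relation.Binary.Reasoning.Setoid FPS-setoid

AgreeUpTo : ℕ → FPS → FPS → Set
AgreeUpTo m f g = ∀ j → j ≤ m → f j ≡ g j

⊛-agree : ∀ {m f f′ g g′} → AgreeUpTo m f f′ → AgreeUpTo m g g′ → AgreeUpTo m (f ⊛ g) (f′ ⊛ g′)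
⊛-agree f≈f′ g≈g′ j j≤m = sumTo-cong (suc j) (λ i i<1+j →
  cong₂ _*_ (f≈f′ i (≤-trans (s≤s⁻¹ i<1+j) j≤m)) (g≈g′ (j ∸ i) (≤-trans (m∸n≤m j i) j≤m)))

pow-agree : ∀ {m f g} → AgreeUpTo m f g → ∀ d → AgreeUpTo m (pow f d) (pow g d)
pow-agree f≈g zero    j _ = refl
pow-agree f≈g (suc d)     = ⊛-agree f≈g (pow-agree f≈g d)

pow-cong : ∀ {f g} → f ≗ g → ∀ d → pow f d ≗ pow g d
pow-cong f≗g d n = pow-agree (λ j _ → f≗g j) d n ≤-refl

-- Monomials, q-integers and geometric series

pow-mono : ∀ a k → pow (mono a) k ≗ mono (a * k)
pow-mono a zero    n = trans (one≗mono0 n) (cong (λ t → mono t n) (sym (*-zeroʳ a)))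
pow-mono a (suc k) n = begin
  (mono a ⊛ pow (mono a) k) n ≡⟨ ⊛-congˡ {mono a} (pow-mono a k) n ⟩
  (mono a ⊛ mono (a * k)) n   ≡⟨ mono⊛mono a (a * k) n ⟩
  mono (a + a * k) n          ≡⟨ cong (λ t → mono t n) (*-suc a k) ⟨
  mono (a * suc k) n          ∎
  where open ≡-Reasoning

mono⊛sumTo : ∀ a K (w : ℕ → ℕ) →
  (mono a ⊛ (λ j → sumTo K (λ k → mono (w k) j))) ≗ (λ j → sumTo K (λ k → mono (a + w k) j))
mono⊛sumTo a K w j = begin
  sumTo (suc j) (λ i → mono a i * sumTo K (λ k → mono (w k) (j ∸ i)))
    ≡⟨ sumTo-cong (suc j) (λ i _ → sumTo-*ˡ K (mono a i) _) ⟩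
  sumTo (suc j) (λ i → sumTo K (λ k → mono a i * mono (w k) (j ∸ i)))
    ≡⟨ sumTo-swap (suc j) K _ ⟩
  sumTo K (λ k → (mono a ⊛ mono (w k)) j)
    ≡⟨ sumTo-cong K (λ k _ → mono⊛mono a (w k) j) ⟩
  sumTo K (λ k → mono (a + w k) j)
    ∎
  where open ≡-Reasoning

bracket-mono : ∀ c p → bracket p (mono c) ≗ λ j → sumTo p (λ l → mono (c * l) j)
bracket-mono c p j = sumTo-cong p (λ l _ → pow-mono c l j)

bracket-t : ∀ b i → bracket b (mono 1) i ≡ χ (i <? b)
bracket-t b i = begin
  bracket b (mono 1) i             ≡⟨ bracket-mono 1 b i ⟩
  sumTo b (λ l → mono (1 * l) i)   ≡⟨ sumTo-cong b (λ l _ → trans (cong (λ t → mono t i) (*-identityˡ l))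
                                                                  (trans (mono-sym l i) (sym (*-identityʳ _)))) ⟩
  sumTo b (λ l → mono i l * 1)     ≡⟨ sumTo-mono b i (λ _ → 1) ⟩
  χ (i <? b) * 1                   ≡⟨ *-identityʳ _ ⟩
  χ (i <? b)                       ∎
  where open ≡-Reasoning

geom-agree : ∀ c′ m → AgreeUpTo m (geom (suc c′)) (λ p → sumTo (suc m) (λ k → mono (suc c′ * k) p))
geom-agree c′ m p p≤m = trans (sumTo-cong (suc p) (λ k _ → pow-mono (suc c′) k p))
  (sym (sumTo-vanishing-tail (suc m) (s≤s p≤m) (λ k p<k _ →
    χ-no (suc c′ * k ≟ p) (λ ck≡p → <⇒≱ p<k (subst (k ≤_) ck≡p (m≤n*m k (suc c′)))))))

module Blocks (b s M m : ℕ) where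

  B : ℕ
  B = suc b

  start : ℕ → ℕ
  start k = s + B * k

  start-mono : ∀ {k l} → k ≤ l → start k ≤ start l
  start-mono k≤l = +-monoʳ-≤ s (*-monoʳ-≤ B k≤l)

  start-suc : ∀ k → start (suc k) ≡ start k + B
  start-suc k = trans (cong (s +_) (*-suc B k)) (shuffle s B (B * k))
    where
    shuffle : ∀ x y z → x + (y + z) ≡ x + z + y
    shuffle = solve 3 (λ x y z → x :+ (y :+ z) := x :+ z :+ y) refl

  inBlock : ℕ → ℕ
  inBlock k = χ (M ≤? k) * (χ (start k ≤? m) * χ (m ∸ start k <? B))

  -- The blocks [start k, start k + B) with k ≥ M tile [start M, ∞).
  sumTo-inBlock : ∀ N → sumTo N inBlock ≡ χ (start M ≤? m) * χ (m <? start N)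
  sumTo-inBlock zero    = sym (χ*χ-exclusive (start M ≤? m) (m <? start 0)
    (λ startM≤m m<start0 → <⇒≱ m<start0 (≤-trans (start-mono z≤n) startM≤m)))
  sumTo-inBlock (suc N) = trans (cong (_+ inBlock N) (sumTo-inBlock N)) (addBlock (m <? start N))
    where
    addBlock : (m<startN : Dec (m < start N)) →
      χ (start M ≤? m) * χ m<startN + inBlock N ≡ χ (start M ≤? m) * χ (m <? start (suc N))
    addBlock (yes m<startN) = trans (cong₂ _+_ stillBefore notInBlockN) (+-identityʳ _)
      where
      stillBefore : χ (start M ≤? m) * χ (yes m<startN) ≡ χ (start M ≤? m) * χ (m <? start (suc N))
      stillBefore = cong (χ (start M ≤? m) *_)
        (sym (χ-yes (m <? start (suc N)) (<-≤-trans m<startN (start-mono (n≤1+n N)))))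
      notInBlockN : inBlock N ≡ 0
      notInBlockN = trans
        (cong (λ x → χ (M ≤? N) * (x * χ (m ∸ start N <? B))) (χ-no (start N ≤? m) (<⇒≱ m<startN)))
        (*-zeroʳ (χ (M ≤? N)))
    addBlock (no m≮startN) = begin
      χ (start M ≤? m) * χ (no m≮startN) + inBlock N
        ≡⟨ cong (_+ inBlock N) (*-zeroʳ (χ (start M ≤? m))) ⟩
      χ (M ≤? N) * (χ (start N ≤? m) * χ (m ∸ start N <? B))
        ≡⟨ cong (χ (M ≤? N) *_) (trans (cong (_* χ (m ∸ start N <? B)) (χ-yes (start N ≤? m) startN≤m))
                                       (+-identityʳ _)) ⟩
      χ (M ≤? N) * χ (m ∸ start N <? B)
        ≡⟨ cong (χ (M ≤? N) *_) (χ-⇔ (m ∸ start N <? B) (m <? start (suc N)) m∸startN<B⇒ m<startN+1⇒) ⟩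
      χ (M ≤? N) * χ (m <? start (suc N))
        ≡⟨ insideBlock (m <? start (suc N)) ⟩
      χ (start M ≤? m) * χ (m <? start (suc N))
        ∎
      where
      open ≡-Reasoning
      startN≤m : start N ≤ m
      startN≤m = ≮⇒≥ m≮startN
      m∸startN<B⇒ : m ∸ start N < B → m < start (suc N)
      m∸startN<B⇒ lt = subst (m <_) (sym (start-suc N))
        (subst (_< start N + B) (m+[n∸m]≡n startN≤m) (+-monoʳ-< (start N) lt))
      m<startN+1⇒ : m < start (suc N) → m ∸ start N < B
      m<startN+1⇒ lt = m<n+o⇒m∸n<o m (start N) (subst (m <_) (start-suc N) lt)
      insideBlock : (m<startN+1 : Dec (m < start (suc N))) →
        χ (M ≤? N) * χ m<startN+1 ≡ χ (start M ≤? m) * χ m<startN+1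
      insideBlock (no _)           = trans (*-zeroʳ (χ (M ≤? N))) (sym (*-zeroʳ (χ (start M ≤? m))))
      insideBlock (yes m<startN+1) = cong (_* 1) (χ-⇔ (M ≤? N) (start M ≤? m)
        (λ M≤N → ≤-trans (start-mono M≤N) startN≤m)
        (λ startM≤m → ≮⇒≥ (λ N<M → <⇒≱ m<startN+1 (≤-trans (start-mono N<M) startM≤m))))

  bracket⊛blocks :
    sumTo (suc m) (λ i → χ (i <? B) * sumTo (suc (m ∸ i)) (λ k → χ (M ≤? k) * mono (start k) (m ∸ i)))
    ≡ χ (start M ≤? m)
  bracket⊛blocks = begin
    sumTo (suc m) (λ i → χ (i <? B) * sumTo (suc (m ∸ i)) (λ k → χ (M ≤? k) * mono (start k) (m ∸ i)))
      ≡⟨ sumTo-cong (suc m) (λ i i<1+m → cong (χ (i <? B) *_) (extend i (s≤s⁻¹ i<1+m))) ⟩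
    sumTo (suc m) (λ i → χ (i <? B) *
      sumTo (suc m) (λ k → χ (M ≤? k) * (χ (start k ≤? m) * mono (m ∸ start k) i)))
      ≡⟨ sumTo-cong (suc m) (λ i _ → trans (sumTo-*ˡ (suc m) (χ (i <? B)) _) (sumTo-cong (suc m) (λ k _ →
           rearrange (χ (i <? B)) (χ (M ≤? k)) (χ (start k ≤? m)) (mono (m ∸ start k) i)))) ⟩
    sumTo (suc m) (λ i → sumTo (suc m) (λ k → mono (m ∸ start k) i * (χ (i <? B) * weight k)))
      ≡⟨ sumTo-swap (suc m) (suc m) _ ⟩
    sumTo (suc m) (λ k → sumTo (suc m) (λ i → mono (m ∸ start k) i * (χ (i <? B) * weight k)))
      ≡⟨ sumTo-cong (suc m) (λ k _ → collapse k) ⟩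
    sumTo (suc m) inBlock
      ≡⟨ sumTo-inBlock (suc m) ⟩
    χ (start M ≤? m) * χ (m <? start (suc m))
      ≡⟨ cong (χ (start M ≤? m) *_)
           (χ-yes (m <? start (suc m)) (≤-trans (m≤n*m (suc m) B) (m≤n+m (B * suc m) s))) ⟩
    χ (start M ≤? m) * 1
      ≡⟨ *-identityʳ _ ⟩
    χ (start M ≤? m)
      ∎
    where
    open ≡-Reasoning
    open import Algebra.Properties.CommutativeSemigroup *-commutativeSemigroup using (x∙yz≈y∙zx)
    weight : ℕ → ℕ
    weight k = χ (M ≤? k) * χ (start k ≤? m)
    rearrange : ∀ a b c d → a * (b * (c * d)) ≡ d * (a * (b * c))
    rearrange = solve 4 (λ a b c d → a :* (b :* (c :* d)) := d :* (a :* (b :* c))) refl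
    extend : ∀ i → i ≤ m →
      sumTo (suc (m ∸ i)) (λ k → χ (M ≤? k) * mono (start k) (m ∸ i))
      ≡ sumTo (suc m) (λ k → χ (M ≤? k) * (χ (start k ≤? m) * mono (m ∸ start k) i))
    extend i i≤m = trans
      (sym (sumTo-vanishing-tail (suc m) (s≤s (m∸n≤m m i)) (λ k m∸i<k _ → trans
        (cong (χ (M ≤? k) *_) (χ-no (start k ≟ m ∸ i) (λ startk≡m∸i →
          <⇒≱ m∸i<k (subst (k ≤_) startk≡m∸i (≤-trans (m≤n*m k B) (m≤n+m (B * k) s))))))
        (*-zeroʳ (χ (M ≤? k))))))
      (sumTo-cong (suc m) (λ k _ → cong (χ (M ≤? k) *_) (mono-∸ (start k) i≤m)))
    collapse : ∀ k → sumTo (suc m) (λ i → mono (m ∸ start k) i * (χ (i <? B) * weight k)) ≡ inBlock k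
    collapse k = begin
      sumTo (suc m) (λ i → mono (m ∸ start k) i * (χ (i <? B) * weight k))
        ≡⟨ sumTo-mono (suc m) (m ∸ start k) (λ i → χ (i <? B) * weight k) ⟩
      χ (m ∸ start k <? suc m) * (χ (m ∸ start k <? B) * weight k)
        ≡⟨ cong (_* (χ (m ∸ start k <? B) * weight k))
                (χ-yes (m ∸ start k <? suc m) (s≤s (m∸n≤m m (start k)))) ⟩
      1 * (χ (m ∸ start k <? B) * weight k)
        ≡⟨ *-identityˡ _ ⟩
      χ (m ∸ start k <? B) * weight k
        ≡⟨ x∙yz≈y∙zx (χ (m ∸ start k <? B)) (χ (M ≤? k)) (χ (start k ≤? m)) ⟩
      inBlock k
        ∎

bracket⊛geom : ∀ c′ → (bracket (suc c′) (mono 1) ⊛ geom (suc c′)) ≗ λ _ → 1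
bracket⊛geom c′ n = begin
  sumTo (suc n) (λ i → bracket (suc c′) (mono 1) i * geom (suc c′) (n ∸ i))
    ≡⟨ sumTo-cong (suc n) (λ i _ → cong₂ _*_ (bracket-t (suc c′) i) (sumTo-cong (suc (n ∸ i)) (λ k _ →
         trans (pow-mono (suc c′) k (n ∸ i))
               (sym (trans (cong (_* mono (suc c′ * k) (n ∸ i)) (χ-yes (0 ≤? k) z≤n)) (+-identityʳ _)))))) ⟩
  sumTo (suc n) (λ i → χ (i <? suc c′) * sumTo (suc (n ∸ i)) (λ k → χ (0 ≤? k) * mono (suc c′ * k) (n ∸ i)))
    ≡⟨ Blocks.bracket⊛blocks c′ 0 0 n ⟩
  χ (suc c′ * 0 ≤? n)
    ≡⟨ χ-yes (suc c′ * 0 ≤? n) (subst (_≤ n) (sym (*-zeroʳ c′)) z≤n) ⟩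
  1
    ∎
  where open ≡-Reasoning

-- Generating functions of finite lists

sumL : {A : Set} → List A → (A → ℕ) → ℕ
sumL []       f = 0
sumL (x ∷ xs) f = f x + sumL xs f

module _ {A : Set} where

  sumL-cong : ∀ (xs : List A) {f g : A → ℕ} → (∀ x → f x ≡ g x) → sumL xs f ≡ sumL xs g
  sumL-cong []       eq = refl
  sumL-cong (x ∷ xs) eq = cong₂ _+_ (eq x) (sumL-cong xs eq)

  sumL-zero : ∀ (xs : List A) {f : A → ℕ} → (∀ x → f x ≡ 0) → sumL xs f ≡ 0
  sumL-zero []       eq = refl
  sumL-zero (x ∷ xs) eq = cong₂ _+_ (eq x) (sumL-zero xs eq)

  sumL-++ : ∀ (xs ys : List A) f → sumL (xs ++ ys) f ≡ sumL xs f + sumL ys f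
  sumL-++ []       ys f = refl
  sumL-++ (x ∷ xs) ys f = trans (cong (f x +_) (sumL-++ xs ys f)) (sym (+-assoc (f x) _ _))

  sumL-+ : ∀ (xs : List A) f g → sumL xs (λ x → f x + g x) ≡ sumL xs f + sumL xs g
  sumL-+ []       f g = refl
  sumL-+ (x ∷ xs) f g = trans (cong (f x + g x +_) (sumL-+ xs f g)) (+-+-swap (f x) (g x) _ _)

  sumL-*ˡ : ∀ (xs : List A) a f → a * sumL xs f ≡ sumL xs (λ x → a * f x)
  sumL-*ˡ []       a f = *-zeroʳ a
  sumL-*ˡ (x ∷ xs) a f = trans (*-distribˡ-+ a (f x) _) (cong (a * f x +_) (sumL-*ˡ xs a f))

  sumL-*ʳ : ∀ (xs : List A) a f → sumL xs f * a ≡ sumL xs (λ x → f x * a)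
  sumL-*ʳ xs a f = trans (*-comm _ a) (trans (sumL-*ˡ xs a f) (sumL-cong xs (λ x → *-comm a (f x))))

  sumTo-sumL : ∀ n (xs : List A) (f : ℕ → A → ℕ) →
    sumTo n (λ i → sumL xs (f i)) ≡ sumL xs (λ x → sumTo n (λ i → f i x))
  sumTo-sumL zero    xs f = sym (sumL-zero xs (λ _ → refl))
  sumTo-sumL (suc n) xs f = trans (cong (_+ sumL xs (f n)) (sumTo-sumL n xs f)) (sym (sumL-+ xs _ (f n)))

  sumL-map : ∀ {B : Set} (g : B → A) (xs : List B) f → sumL (map g xs) f ≡ sumL xs (λ x → f (g x))
  sumL-map g []       f = refl
  sumL-map g (x ∷ xs) f = cong (f (g x) +_) (sumL-map g xs f)

  sumL-applyUpTo : ∀ n (g : ℕ → A) f → sumL (applyUpTo g n) f ≡ sumTo n (λ i → f (g i))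
  sumL-applyUpTo zero    g f = refl
  sumL-applyUpTo (suc n) g f = trans (cong (f (g 0) +_) (sumL-applyUpTo n (λ i → g (suc i)) f))
                                     (sym (sumTo-shiftˡ n (λ i → f (g i))))

  length-filter : ∀ {P : A → Set} (P? : ∀ x → Dec (P x)) (xs : List A) →
    length (filter P? xs) ≡ sumL xs (λ x → χ (P? x))
  length-filter P? []       = refl
  length-filter P? (x ∷ xs) with P? x
  ... | yes _ = cong suc (length-filter P? xs)
  ... | no _  = length-filter P? xs

sumL-cartesianProductWith : ∀ {A B C : Set} (h : A → B → C) (xs : List A) (ys : List B) f →
  sumL (cartesianProductWith h xs ys) f ≡ sumL xs (λ a → sumL ys (λ b → f (h a b)))
sumL-cartesianProductWith h []       ys f = refl
sumL-cartesianProductWith h (x ∷ xs) ys f = trans (sumL-++ (map (h x) ys) _ f)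
  (cong₂ _+_ (sumL-map (h x) ys f) (sumL-cartesianProductWith h xs ys f))

⊛-distribʳ-sumL : ∀ {A : Set} (zs : List A) (u : A → ℕ) (F : A → FPS) (g : FPS) →
  ((λ j → sumL zs (λ z → u z * F z j)) ⊛ g) ≗ (λ j → sumL zs (λ z → u z * (F z ⊛ g) j))
⊛-distribʳ-sumL zs u F g n = begin
  sumTo (suc n) (λ i → sumL zs (λ z → u z * F z i) * g (n ∸ i))
    ≡⟨ sumTo-cong (suc n) (λ i _ →
         trans (sumL-*ʳ zs (g (n ∸ i)) _) (sumL-cong zs (λ z → *-assoc (u z) _ _))) ⟩
  sumTo (suc n) (λ i → sumL zs (λ z → u z * (F z i * g (n ∸ i))))
    ≡⟨ sumTo-sumL (suc n) zs _ ⟩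
  sumL zs (λ z → sumTo (suc n) (λ i → u z * (F z i * g (n ∸ i))))
    ≡⟨ sumL-cong zs (λ z → sumTo-*ˡ (suc n) (u z) _) ⟨
  sumL zs (λ z → u z * (F z ⊛ g) n)
    ∎
  where open ≡-Reasoning

gf : {A : Set} → List A → (A → ℕ) → (A → ℕ) → FPS
gf zs u v j = sumL zs (λ z → u z * mono (v z) j)

gf⊛mono : ∀ {A : Set} (zs : List A) u v a → (gf zs u v ⊛ mono a) ≗ gf zs u (λ z → v z + a)
gf⊛mono zs u v a n = trans (⊛-distribʳ-sumL zs u (mono ∘ v) (mono a) n)
                           (sumL-cong zs (λ z → cong (u z *_) (mono⊛mono (v z) a n)))

gf⊛gf : ∀ {A B : Set} (zs : List A) (ws : List B) u v u′ v′ →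
  (gf zs u v ⊛ gf ws u′ v′) ≗ λ n → sumL zs (λ z → sumL ws (λ w → u z * u′ w * mono (v z + v′ w) n))
gf⊛gf zs ws u v u′ v′ n = begin
  (gf zs u v ⊛ gf ws u′ v′) n
    ≡⟨ ⊛-distribʳ-sumL zs u (mono ∘ v) (gf ws u′ v′) n ⟩
  sumL zs (λ z → u z * (mono (v z) ⊛ gf ws u′ v′) n)
    ≡⟨ sumL-cong zs (λ z → cong (u z *_)
         (trans (⊛-comm (mono (v z)) (gf ws u′ v′) n) (gf⊛mono ws u′ v′ (v z) n))) ⟩
  sumL zs (λ z → u z * sumL ws (λ w → u′ w * mono (v′ w + v z) n))
    ≡⟨ sumL-cong zs (λ z → trans (sumL-*ˡ ws (u z) _) (sumL-cong ws (λ w →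
         trans (sym (*-assoc (u z) (u′ w) _)) (cong (λ t → u z * u′ w * mono t n) (+-comm (v′ w) (v z)))))) ⟩
  sumL zs (λ z → sumL ws (λ w → u z * u′ w * mono (v z + v′ w) n))
    ∎
  where open ≡-Reasoning

allVecs : {A : Set} → List A → (d : ℕ) → List (Vec A d)
allVecs zs zero    = []ᵥ ∷ []
allVecs zs (suc d) = cartesianProductWith _∷ᵥ_ zs (allVecs zs d)

prodV : ∀ {A : Set} {d} → (A → ℕ) → Vec A d → ℕ
prodV u []ᵥ       = 1
prodV u (z ∷ᵥ x) = u z * prodV u x

pow-gf : ∀ {A : Set} (zs : List A) u v d →
  pow (gf zs u v) d ≗ gf (allVecs zs d) (prodV u) (λ x → sum (mapᵥ v x))
pow-gf zs u v zero    n = trans (one≗mono0 n) (sym (trans (+-identityʳ _) (*-identityˡ _)))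
pow-gf zs u v (suc d) n = begin
  (gf zs u v ⊛ pow (gf zs u v) d) n
    ≡⟨ ⊛-congˡ {gf zs u v} (pow-gf zs u v d) n ⟩
  (gf zs u v ⊛ gf (allVecs zs d) (prodV u) (λ x → sum (mapᵥ v x))) n
    ≡⟨ gf⊛gf zs (allVecs zs d) u v (prodV u) (λ x → sum (mapᵥ v x)) n ⟩
  sumL zs (λ z → sumL (allVecs zs d) (λ x → u z * prodV u x * mono (v z + sum (mapᵥ v x)) n))
    ≡⟨ sumL-cartesianProductWith _∷ᵥ_ zs (allVecs zs d) _ ⟨
  gf (allVecs zs (suc d)) (prodV u) (λ x → sum (mapᵥ v x)) n
    ∎
  where open ≡-Reasoning

∈-allVecs : ∀ {A : Set} {zs : List A} {d} {x : Vec A d} → All (_∈ zs) x → x ∈ allVecs zs d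
∈-allVecs []ᵃ              = here refl
∈-allVecs (z∈zs ∷ᵃ x∈zsᵈ) = ∈-cartesianProductWith⁺ _∷ᵥ_ z∈zs (∈-allVecs x∈zsᵈ)

allVecs-unique : ∀ {A : Set} {zs : List A} → Unique zs → ∀ d → Unique (allVecs zs d)
allVecs-unique zs! zero    = ListAll.[] AllPairs.∷ AllPairs.[]
allVecs-unique zs! (suc d) = Unique.cartesianProductWith⁺ _∷ᵥ_ ∷-injective zs! (allVecs-unique zs! d)

-- Integer points

ℤ-ball : ℕ → List ℤ
ℤ-ball m = map pos (upTo (suc m)) ++ map -[1+_] (upTo m)

sumL-ℤ-ball : ∀ m f → sumL (ℤ-ball m) f ≡ sumTo (suc m) (λ l → f (pos l)) + sumTo m (λ l → f -[1+ l ])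
sumL-ℤ-ball m f = trans (sumL-++ (map pos (upTo (suc m))) _ f)
  (cong₂ _+_ (trans (sumL-map pos (upTo (suc m)) f) (sumL-applyUpTo (suc m) (λ i → i) _))
             (trans (sumL-map -[1+_] (upTo m) f) (sumL-applyUpTo m (λ i → i) _)))

∈-ℤ-ball : ∀ {m} z → ∣ z ∣ ≤ m → z ∈ ℤ-ball m
∈-ℤ-ball {m} (pos l)   l≤m = ∈-++⁺ˡ (∈-map⁺ pos (∈-upTo⁺ (s≤s l≤m)))
∈-ℤ-ball {m} -[1+ l ] l<m = ∈-++⁺ʳ (map pos (upTo (suc m))) (∈-map⁺ -[1+_] (∈-upTo⁺ l<m))

ℤ-ball-unique : ∀ m → Unique (ℤ-ball m)
ℤ-ball-unique m = Unique.++⁺ (Unique.map⁺ +-injective (Unique.upTo⁺ (suc m)))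
                             (Unique.map⁺ -[1+-injective (Unique.upTo⁺ m)) disjoint
  where
  disjoint : ∀ {z} → ¬ (z ∈ map pos (upTo (suc m)) × z ∈ map -[1+_] (upTo m))
  disjoint (z∈pos , z∈neg) with ∈-map⁻ pos z∈pos | ∈-map⁻ -[1+_] z∈neg
  ... | _ , _ , refl | _ , _ , ()

ballSeries : ℕ → ℕ → FPS
ballSeries c k = bracket (suc k) (mono c) ⊕ (mono c ⊛ bracket k (mono c))

ballSeries-gf : ∀ c {k m} → k ≤ m →
  ballSeries c k ≗ gf (ℤ-ball m) (λ z → χ (∣ z ∣ ≤? k)) (λ z → c * ∣ z ∣)
ballSeries-gf c {k} {m} k≤m j = sym (begin
  gf (ℤ-ball m) (λ z → χ (∣ z ∣ ≤? k)) (λ z → c * ∣ z ∣) j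
    ≡⟨ sumL-ℤ-ball m _ ⟩
  sumTo (suc m) (λ l → χ (l ≤? k) * mono (c * l) j) + negative
    ≡⟨ cong (_+ negative) (sumTo-cong (suc m) (λ l _ →
         cong (_* mono (c * l) j) (χ-⇔ (l ≤? k) (l <? suc k) s≤s s≤s⁻¹))) ⟩
  sumTo (suc m) (λ l → χ (l <? suc k) * mono (c * l) j) + negative
    ≡⟨ cong₂ _+_ (sumTo-χ< (suc m) _ (s≤s k≤m)) (sumTo-χ< m _ k≤m) ⟩
  sumTo (suc k) (λ l → mono (c * l) j) + sumTo k (λ l → mono (c * suc l) j)
    ≡⟨ cong₂ _+_ (sym (bracket-mono c (suc k) j)) (sym shifted) ⟩
  ballSeries c k j
    ∎)
  where
  open ≡-Reasoning
  negative : ℕ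
  negative = sumTo m (λ l → χ (l <? k) * mono (c * suc l) j)
  shifted : (mono c ⊛ bracket k (mono c)) j ≡ sumTo k (λ l → mono (c * suc l) j)
  shifted = trans (⊛-congˡ {mono c} (bracket-mono c k) j) (trans (mono⊛sumTo c k (c *_) j)
    (sumTo-cong k (λ l _ → cong (λ t → mono t j) (sym (*-suc c l)))))

geom±-agree : ∀ c′ m → let c = suc c′ in
  AgreeUpTo m ((one ⊕ mono c) ⊛ geom c) (gf (ℤ-ball m) (λ _ → 1) (λ z → c * ∣ z ∣))
geom±-agree c′ m j j≤m = begin
  ((one ⊕ mono c) ⊛ geom c) j
    ≡⟨ ⊛-distribʳ-⊕ one (mono c) (geom c) j ⟩
  (one ⊛ geom c) j + (mono c ⊛ geom c) j
    ≡⟨ cong₂ _+_ (trans (⊛-identityˡ (geom c) j) (geom-agree c′ m j j≤m))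
                 (⊛-agree {f = mono c} {g′ = S} (λ _ _ → refl) (geom-agree c′ m) j j≤m) ⟩
  S j + (mono c ⊛ S) j
    ≡⟨ cong (S j +_) (trans (mono⊛sumTo c (suc m) (c *_) j) lastVanishes) ⟩
  sumTo (suc m) (λ l → mono (c * l) j) + sumTo m (λ l → mono (c * suc l) j)
    ≡⟨ cong₂ _+_ (sumTo-cong (suc m) (λ l _ → sym (*-identityˡ _)))
                 (sumTo-cong m (λ l _ → sym (*-identityˡ _))) ⟩
  sumTo (suc m) (λ l → 1 * mono (c * l) j) + sumTo m (λ l → 1 * mono (c * suc l) j)
    ≡⟨ sumL-ℤ-ball m _ ⟨
  gf (ℤ-ball m) (λ _ → 1) (λ z → c * ∣ z ∣) j
    ∎
  where
  open ≡-Reasoning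
  c = suc c′
  S : FPS
  S p = sumTo (suc m) (λ k → mono (c * k) p)
  lastVanishes : sumTo (suc m) (λ k → mono (c + c * k) j) ≡ sumTo m (λ k → mono (c * suc k) j)
  lastVanishes = trans
    (cong₂ _+_ (sumTo-cong m (λ k _ → cong (λ t → mono t j) (sym (*-suc c k))))
               (χ-no (c + c * m ≟ j) (λ c+cm≡j → <⇒≱ (s≤s (≤-trans (m≤n*m m c) (m≤n+m (c * m) c′)))
                                                     (subst (_≤ m) (sym c+cm≡j) j≤m))))
    (+-identityʳ _)

-- Lattice points of kP

maxAbs : ∀ {d} → Vec ℤ d → ℕ
maxAbs x = foldr (λ _ → ℕ) _⊔_ 0 (mapᵥ ∣_∣ x)

sumAbs : ∀ {d} → Vec ℤ d → ℕ
sumAbs x = sum (mapᵥ ∣_∣ x)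

box : (d : ℕ) → ℕ → List (Vec ℤ d)
box d m = allVecs (ℤ-ball m) d

InKP? : ∀ d b c k (x : Vec ℤ d) → Dec (InKP d b c k x)
InKP? d b c k x = c * sumAbs x + b * maxAbs x ≤? k

maxAbs≤⇒All : ∀ {d m} (x : Vec ℤ d) → maxAbs x ≤ m → All (λ z → ∣ z ∣ ≤ m) x
maxAbs≤⇒All []ᵥ       _  = []ᵃ
maxAbs≤⇒All (z ∷ᵥ x) le =
  ≤-trans (m≤m⊔n ∣ z ∣ (maxAbs x)) le ∷ᵃ maxAbs≤⇒All x (≤-trans (m≤n⊔m ∣ z ∣ (maxAbs x)) le)

maxAbs≤sumAbs : ∀ {d} (x : Vec ℤ d) → maxAbs x ≤ sumAbs x
maxAbs≤sumAbs []ᵥ       = z≤n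
maxAbs≤sumAbs (z ∷ᵥ x) =
  ⊔-lub (m≤m+n ∣ z ∣ (sumAbs x)) (≤-trans (maxAbs≤sumAbs x) (m≤n+m (sumAbs x) ∣ z ∣))

-- The only use of ¬ (b ≡ 0 × c ≡ 0): it makes kP bounded.
InKP⇒∈box : ∀ d b c k (x : Vec ℤ d) → ¬ (b ≡ 0 × c ≡ 0) → InKP d b c k x → x ∈ box d k
InKP⇒∈box d b c k x b,c≢0 x∈kP =
  ∈-allVecs (mapᵃ (∈-ℤ-ball _) (maxAbs≤⇒All x (maxAbs≤ b c b,c≢0 x∈kP)))
  where
  maxAbs≤ : ∀ b c → ¬ (b ≡ 0 × c ≡ 0) → c * sumAbs x + b * maxAbs x ≤ k → maxAbs x ≤ k
  maxAbs≤ (suc b) c       _      le = ≤-trans (m≤n*m (maxAbs x) (suc b)) (≤-trans (m≤n+m _ (c * sumAbs x)) le)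
  maxAbs≤ zero    (suc c) _      le =
    ≤-trans (maxAbs≤sumAbs x) (≤-trans (m≤n*m (sumAbs x) (suc c)) (≤-trans (m≤m+n _ 0) le))
  maxAbs≤ zero    zero    b,c≢0 _  = ⊥-elim (b,c≢0 (refl , refl))

prodV-χ≤ : ∀ k {d} (x : Vec ℤ d) → prodV (λ z → χ (∣ z ∣ ≤? k)) x ≡ χ (maxAbs x ≤? k)
prodV-χ≤ k []ᵥ       = sym (χ-yes (0 ≤? k) z≤n)
prodV-χ≤ k (z ∷ᵥ x) = trans (cong (χ (∣ z ∣ ≤? k) *_) (prodV-χ≤ k x)) (χ-⊔ ∣ z ∣ (maxAbs x) k)

prodV-const1 : ∀ {A : Set} {d} (x : Vec A d) → prodV (λ _ → 1) x ≡ 1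
prodV-const1 []ᵥ       = refl
prodV-const1 (z ∷ᵥ x) = trans (+-identityʳ _) (prodV-const1 x)

sum-map-*ˡ : ∀ {A : Set} {d} c (f : A → ℕ) (x : Vec A d) →
  sum (mapᵥ (λ z → c * f z) x) ≡ c * sum (mapᵥ f x)
sum-map-*ˡ c f []ᵥ       = sym (*-zeroʳ c)
sum-map-*ˡ c f (z ∷ᵥ x) = trans (cong (c * f z +_) (sum-map-*ˡ c f x)) (sym (*-distribˡ-+ c (f z) _))

pow-ballSeries⊛mono : ∀ b′ c d m k → k ≤ m →
  (pow (ballSeries c k) d ⊛ pow (mono (suc b′)) k)
  ≗ λ n → sumL (box d m) (λ x → χ (maxAbs x ≤? k) * mono (c * sumAbs x + suc b′ * k) n)
pow-ballSeries⊛mono b′ c d m k k≤m n = begin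
  (pow (ballSeries c k) d ⊛ pow (mono (suc b′)) k) n
    ≡⟨ ⊛-cong (pow-cong (ballSeries-gf c k≤m) d) (pow-mono (suc b′) k) n ⟩
  (pow (gf (ℤ-ball m) u v) d ⊛ mono (suc b′ * k)) n
    ≡⟨ ⊛-cong {g = mono (suc b′ * k)} (pow-gf (ℤ-ball m) u v d) (λ _ → refl) n ⟩
  (gf (box d m) (prodV u) (λ x → sum (mapᵥ v x)) ⊛ mono (suc b′ * k)) n
    ≡⟨ gf⊛mono (box d m) (prodV u) (λ x → sum (mapᵥ v x)) (suc b′ * k) n ⟩
  gf (box d m) (prodV u) (λ x → sum (mapᵥ v x) + suc b′ * k) n
    ≡⟨ sumL-cong (box d m) (λ x →
         cong₂ (λ w t → w * mono (t + suc b′ * k) n) (prodV-χ≤ k x) (sum-map-*ˡ c ∣_∣ x)) ⟩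
  sumL (box d m) (λ x → χ (maxAbs x ≤? k) * mono (c * sumAbs x + suc b′ * k) n)
    ∎
  where
  open ≡-Reasoning
  u v : ℤ → ℕ
  u z = χ (∣ z ∣ ≤? k)
  v z = c * ∣ z ∣

latticeCount-suc : ∀ b′ c d m → sumL (box d m) (λ x → χ (InKP? d (suc b′) c m x)) ≡ ehrRHS (suc b′) c d m
latticeCount-suc b′ c d m = sym (begin
  ehrRHS (suc b′) c d m
    ≡⟨ sumTo-cong (suc m) (λ i _ → cong₂ _*_ (bracket-t (suc b′) i)
         (sumTo-cong (suc (m ∸ i)) (λ k k<1+m∸i →
           pow-ballSeries⊛mono b′ c d m k (≤-trans (s≤s⁻¹ k<1+m∸i) (m∸n≤m m i)) (m ∸ i)))) ⟩
  sumTo (suc m) (λ i → χ (i <? suc b′) * sumTo (suc (m ∸ i)) (λ k → sumL (box d m) (term i k)))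
    ≡⟨ sumTo-cong (suc m) (λ i _ →
         trans (cong (χ (i <? suc b′) *_) (sumTo-sumL (suc (m ∸ i)) (box d m) (term i)))
               (sumL-*ˡ (box d m) (χ (i <? suc b′)) _)) ⟩
  sumTo (suc m) (λ i → sumL (box d m) (λ x → χ (i <? suc b′) * sumTo (suc (m ∸ i)) (λ k → term i k x)))
    ≡⟨ sumTo-sumL (suc m) (box d m) _ ⟩
  sumL (box d m) (λ x → sumTo (suc m) (λ i → χ (i <? suc b′) * sumTo (suc (m ∸ i)) (λ k → term i k x)))
    ≡⟨ sumL-cong (box d m) (λ x → Blocks.bracket⊛blocks b′ (c * sumAbs x) (maxAbs x) m) ⟩
  sumL (box d m) (λ x → χ (InKP? d (suc b′) c m x))
    ∎)
  where
  open ≡-Reasoning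
  term : ℕ → ℕ → Vec ℤ d → ℕ
  term i k x = χ (maxAbs x ≤? k) * mono (c * sumAbs x + suc b′ * k) (m ∸ i)

latticeCount-zero : ∀ c′ d m → sumL (box d m) (λ x → χ (InKP? d 0 (suc c′) m x)) ≡ ehrRHS 0 (suc c′) d m
latticeCount-zero c′ d m = sym (begin
  (bracket c (mono 1) ⊛ (pow P d ⊛ pow G (suc d))) m
    ≡⟨ ⊛-congˡ {bracket c (mono 1)} (pow⊛pow-suc P G d) m ⟩
  (bracket c (mono 1) ⊛ (G ⊛ pow (P ⊛ G) d)) m
    ≡⟨ ⊛-assoc (bracket c (mono 1)) G (pow (P ⊛ G) d) m ⟨
  ((bracket c (mono 1) ⊛ G) ⊛ pow (P ⊛ G) d) m
    ≡⟨ trans (⊛-cong {g = pow (P ⊛ G) d} (bracket⊛geom c′) (λ _ → refl) m)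
             (⊛-comm (λ _ → 1) (pow (P ⊛ G) d) m) ⟩
  sumTo (suc m) (λ j → pow (P ⊛ G) d j * 1)
    ≡⟨ sumTo-cong (suc m) (λ j j<1+m → trans (*-identityʳ _)
         (trans (pow-agree (geom±-agree c′ m) d j (s≤s⁻¹ j<1+m)) (pow-gf (ℤ-ball m) (λ _ → 1) v d j))) ⟩
  sumTo (suc m) (λ j → sumL (box d m) (λ x → prodV (λ _ → 1) x * mono (sum (mapᵥ v x)) j))
    ≡⟨ sumTo-sumL (suc m) (box d m) _ ⟩
  sumL (box d m) (λ x → sumTo (suc m) (λ j → prodV (λ _ → 1) x * mono (sum (mapᵥ v x)) j))
    ≡⟨ sumL-cong (box d m) count ⟩
  sumL (box d m) (λ x → χ (InKP? d 0 c m x))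
    ∎)
  where
  open ≡-Reasoning
  c = suc c′
  P G : FPS
  P = one ⊕ mono c
  G = geom c
  v : ℤ → ℕ
  v z = c * ∣ z ∣
  count : ∀ x → sumTo (suc m) (λ j → prodV (λ _ → 1) x * mono (sum (mapᵥ v x)) j) ≡ χ (InKP? d 0 c m x)
  count x = begin
    sumTo (suc m) (λ j → prodV (λ _ → 1) x * mono (sum (mapᵥ v x)) j)
      ≡⟨ sumTo-cong (suc m) (λ j _ → trans (cong (_* mono (sum (mapᵥ v x)) j) (prodV-const1 x))
                                           (*-comm 1 (mono (sum (mapᵥ v x)) j))) ⟩
    sumTo (suc m) (λ j → mono (sum (mapᵥ v x)) j * 1)
      ≡⟨ sumTo-mono (suc m) (sum (mapᵥ v x)) (λ _ → 1) ⟩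
    χ (sum (mapᵥ v x) <? suc m) * 1
      ≡⟨ *-identityʳ _ ⟩
    χ (sum (mapᵥ v x) <? suc m)
      ≡⟨ χ-⇔ (sum (mapᵥ v x) <? suc m) (InKP? d 0 c m x)
           (λ lt → subst (_≤ m) (trans (sum-map-*ˡ c ∣_∣ x) (sym (+-identityʳ _))) (s≤s⁻¹ lt))
           (λ le → s≤s (subst (_≤ m) (trans (+-identityʳ _) (sym (sum-map-*ˡ c ∣_∣ x))) le)) ⟩
    χ (InKP? d 0 c m x)
      ∎

latticeCount : ∀ b c d k → ¬ (b ≡ 0 × c ≡ 0) → sumL (box d k) (λ x → χ (InKP? d b c k x)) ≡ ehrRHS b c d k
latticeCount (suc b′) c       d k _      = latticeCount-suc b′ c d k
latticeCount zero     (suc c′) d k _      = latticeCount-zero c′ d k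
latticeCount zero     zero    d k b,c≢0 = ⊥-elim (b,c≢0 (refl , refl))

corollary4p5 : (b c d : ℕ) → ¬ (b ≡ 0 × c ≡ 0) →
    (k : ℕ) → HasCard (InKP d b c k) (ehrRHS b c d k)
corollary4p5 b c d b,c≢0 k =
  filter (InKP? d b c k) (box d k) ,
  Unique.filter⁺ (InKP? d b c k) (allVecs-unique (ℤ-ball-unique k) d) ,
  (λ x → (λ x∈ → proj₂ (∈-filter⁻ (InKP? d b c k) {xs = box d k} x∈)) ,
         (λ x∈kP → ∈-filter⁺ (InKP? d b c k) (InKP⇒∈box d b c k x b,c≢0 x∈kP) x∈kP)) ,
  trans (length-filter (InKP? d b c k) (box d k)) (latticeCount b c d k b,c≢0)
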